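{- Consider the multi-tree model below. For any pair of nodes $u,v$, after $\mathrm{Whole}(u,v)$ runs: if it returns true, the triple $(-|E|,\,Y,\,-S)$ strictly decreases in lexicographic order (by at least one in the first coordinate that changes); if it returns false, $(-|E|,Y,-S)$ does not change.
   Context: Model: $V=\{1,\dots,N\}$ nodes (integer ids), $\mathcal R=\{1,\dots,M\}\subseteq V$ roots (colors), $K$ an integer with $1\le K\le M$. $E$ is a set of directed links, each colored by one $i\in\mathcal R$; $E_i$ = links of color $i$ ("$i$-links"). Each root $i$ is regarded as always having an incoming $i$-link from an external server (not in $E$). Node $u$ has outdegree capacity $\bar d_u$. $L_i(u)$ = minimum number of hops from $i$ to $u$ in $(V,E_i)$ ($+\infty$ if none). $d_i(u)$ = number of outgoing $i$-links of $u$, $d(u)=\sum_i d_i(u)$; $i$-parent/$i$-child as usual. Define $L'_i(u)=\min\{L_i(u),N\}$, $Y=\sum_{u\in V}\sum_{i\in\mathcal R}L'_i(u)$, $D(u)=\sum_{i\in\mathcal R} i\,d_i(u)$, $S=\sum_{u\in V}u\,D(u)$. All nodes use exact depths $L_i$. $\mathrm{Greedy}(u,u_p)$: if $u$ has fewer than $K$ incoming links and there is $i$ such that $u$ has no incoming $i$-link but $u_p$ has one, then (Add) if $d(u_p)<\bar d_{u_p}$ add $(u_p,u)$ to $E_i$, return true; (Insert) else if $u_p$ has an $i$-child $u_c$, remove $(u_p,u_c)$, add $(u_p,u),(u,u_c)$ to $E_i$, return true. Otherwise false. $\mathrm{Single}(u,v)$: if there is $i$ with $u,v$ both having an incoming $i$-link,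 then (Jump) if $d(v)<\bar d_v$ and $L_i(v)+1<L_i(u)$, replace $u$'s incoming $i$-link $(u_p,u)$ by $(v,u)$, return true; (LeafSwap) else if $d_i(v)=0$, $d_i(u)\ge1$, $L_i(u)>L_i(v)$, with $u_p,v_p$ the $i$-parents of $u,v$, replace $(u_p,u),(v_p,v)$ by $(u_p,v),(v_p,u)$, return true. Otherwise false. $\mathrm{MixSwap}(u_c,v)$: if there exist $i\ne j$, a $j$-child $v_c$ of $v$ and an $i$-parent $u$ of $u_c$ with $L_i(u)\ge L_i(v)$, $L_j(u)\le L_j(v)$ and either (a) $L_i(u)\ne L_i(v)$ or $L_j(u)\ne L_j(v)$, or (b) $L_i(u)=L_i(v)$, $L_j(u)=L_j(v)$, $(u-v)(j-i)>0$, then remove $(u,u_c),(v,v_c)$, add $(u,v_c)$ to $E_j$, $(v,u_c)$ to $E_i$, return true. Otherwise false. $\mathrm{Whole}(u,v)$: run $\mathrm{Greedy}(u,v)$; if it returns false run $\mathrm{Single}(u,v)$; if that returns false run $\mathrm{MixSwap}(u,v)$; return true iff one of them returned true. Ties broken arbitrarily. -}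

module Defs where

open import Data.Nat using (ℕ; zero; suc; _+_; _*_; _≤_; _<_; _⊓_; _≡ᵇ_)
open import Data.Bool using (Bool; true; false; _∧_; _∨_; not; if_then_else_)
open import Data.Integer as ℤ using (ℤ; +_; -_; 1ℤ; 0ℤ)
open import Data.Product using (Σ; ∃; ∃-syntax; _×_; _,_)
open import Data.Sum using (_⊎_)
open import Data.Empty using (⊥)
open import Relation.Nullary using (¬_)
open import Relation.Binary.PropositionalEquality using (_≡_; _≢_)

sumTo : ℕ → (ℕ → ℕ) → ℕ
sumTo zero    f = 0
sumTo (suc n) f = sumTo n f + f (suc n)

anyTo : ℕ → (ℕ → Bool) → Bool
anyTo zero    p = false
anyTo (suc n) p = anyTo n p ∨ p (suc n)

count : Bool → ℕ
count b = if b then 1 else 0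

data ℕ∞ : Set where
  fin : ℕ → ℕ∞
  ∞   : ℕ∞

suc∞ : ℕ∞ → ℕ∞
suc∞ (fin n) = fin (suc n)
suc∞ ∞       = ∞

data _<∞_ : ℕ∞ → ℕ∞ → Set where
  fin<fin : ∀ {m n} → m < n → fin m <∞ fin n
  fin<∞   : ∀ {m} → fin m <∞ ∞

data _≤∞_ : ℕ∞ → ℕ∞ → Set where
  fin≤fin : ∀ {m n} → m ≤ n → fin m ≤∞ fin n
  x≤∞     : ∀ {x} → x ≤∞ ∞

min∞ : ℕ∞ → ℕ → ℕ
min∞ (fin k) n = k ⊓ n
min∞ ∞       n = n

search : (ℕ → Bool) → ℕ → ℕ∞
search p zero    = ∞
search p (suc n) = if p 0 then fin 0 else suc∞ (search (λ k → p (suc k)) n)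

-- Link sets.  E a b i = true  iff the i-link (a , b) is in E, i.e.
-- (a , b) ∈ E_i.  E is the set of colored links (a set of triples).

Links : Set
Links = ℕ → ℕ → ℕ → Bool

ins : ℕ → ℕ → ℕ → Links → Links
ins a b c E x y z = E x y z ∨ ((a ≡ᵇ x) ∧ ((b ≡ᵇ y) ∧ (c ≡ᵇ z)))

del : ℕ → ℕ → ℕ → Links → Links
del a b c E x y z = E x y z ∧ not ((a ≡ᵇ x) ∧ ((b ≡ᵇ y) ∧ (c ≡ᵇ z)))

InV : ℕ → ℕ → Set
InV N u = 1 ≤ u × u ≤ N

-- Quantities of the model, for V = {1..N}, R = {1..M}

module _ (N M : ℕ) where

  size : Links → ℕ
  size E = sumTo N (λ a → sumTo N (λ b → sumTo M (λ i → count (E a b i))))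

  dcol : Links → ℕ → ℕ → ℕ
  dcol E i u = sumTo N (λ w → count (E u w i))

  deg : Links → ℕ → ℕ
  deg E u = sumTo M (λ i → dcol E i u)

  Dw : Links → ℕ → ℕ
  Dw E u = sumTo M (λ i → i * dcol E i u)

  S : Links → ℕ
  S E = sumTo N (λ u → u * Dw E u)

  -- number of incoming links of u (a root additionally has its
  -- incoming link from the external server)
  inDeg : Links → ℕ → ℕ
  inDeg E u = sumTo N (λ a → sumTo M (λ i → count (E a u i)))
              + count (not (u ≡ᵇ 0) ∧ Data.Nat._≤ᵇ_ u M)

  reach : Links → ℕ → ℕ → ℕ → Bool
  reach E i zero    u = u ≡ᵇ i
  reach E i (suc k) u = reach E i k u ∨ anyTo N (λ a → reach E i k a ∧ E a u i)

  -- L_i(u): minimum number of hops from i to u in (V,E_i), +∞ if none.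
  -- (A shortest path visits distinct nodes of V, so it has < N hops;
  --  hence searching k < N is exact.)
  L : Links → ℕ → ℕ → ℕ∞
  L E i u = search (λ k → reach E i k u) N

  L' : Links → ℕ → ℕ → ℕ
  L' E i u = min∞ (L E i u) N

  Y : Links → ℕ
  Y E = sumTo N (λ u → sumTo M (λ i → L' E i u))

  -- u has an incoming i-link (the root i always has one, from the server)
  HasIn : Links → ℕ → ℕ → Set
  HasIn E u i = (u ≡ i) ⊎ (∃[ a ] E a u i ≡ true)

  triple : Links → ℤ × ℤ × ℤ
  triple E = (- (+ size E)) , (+ Y E) , (- (+ S E))

  record MultiTree (E : Links) : Set where
    field
      wf         : ∀ a b i → E a b i ≡ true → InV N a × InV N b × InV M i
      uniqParent : ∀ a a' b i → E a b i ≡ true → E a' b i ≡ true → a ≡ a'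
      rootNoIn   : ∀ a i → E a i i ≡ true → ⊥

LexDecr : ℤ × ℤ × ℤ → ℤ × ℤ × ℤ → Set
LexDecr (a' , b' , c') (a , b , c) =
  (a' ℤ.+ 1ℤ ℤ.≤ a)
  ⊎ ((a' ≡ a) × (b' ℤ.+ 1ℤ ℤ.≤ b))
  ⊎ ((a' ≡ a) × (b' ≡ b) × (c' ℤ.+ 1ℤ ℤ.≤ c))

-- The operations, as (nondeterministic) relations
--   Op ... E b E'  :  running Op on state E may return b with new state E'.

module _ (N M K : ℕ) (dbar : ℕ → ℕ) where

  GreedyColour : Links → ℕ → ℕ → ℕ → Set
  GreedyColour E u up i = InV M i × ¬ HasIn N M E u i × HasIn N M E up i

  data Greedy (E : Links) (u up : ℕ) : Bool → Links → Set where
    add    : ∀ i → inDeg N M E u < K → GreedyColour E u up i →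
             deg N M E up < dbar up →
             Greedy E u up true (ins up u i E)
    insert : ∀ i uc → inDeg N M E u < K → GreedyColour E u up i →
             ¬ (deg N M E up < dbar up) → E up uc i ≡ true →
             Greedy E u up true (ins u uc i (ins up u i (del up uc i E)))
    fail₁  : ∀ i → inDeg N M E u < K → GreedyColour E u up i →
             ¬ (deg N M E up < dbar up) → (∀ uc → E up uc i ≡ true → ⊥) →
             Greedy E u up false E
    fail₂  : ¬ (inDeg N M E u < K × ∃[ i ] GreedyColour E u up i) →
             Greedy E u up false E

  SingleColour : Links → ℕ → ℕ → ℕ → Set
  SingleColour E u v i = InV M i × HasIn N M E u i × HasIn N M E v i

  JumpCond : Links → ℕ → ℕ → ℕ → Set
  JumpCond E u v i = deg N M E v < dbar v × suc∞ (L N M E i v) <∞ L N M E i u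

  LeafCond : Links → ℕ → ℕ → ℕ → Set
  LeafCond E u v i = dcol N M E i v ≡ 0 × 1 ≤ dcol N M E i u
                     × L N M E i v <∞ L N M E i u

  data Single (E : Links) (u v : ℕ) : Bool → Links → Set where
    jump     : ∀ i up → SingleColour E u v i → JumpCond E u v i →
               E up u i ≡ true →
               Single E u v true (ins v u i (del up u i E))
    leafSwap : ∀ i up vp → SingleColour E u v i → ¬ JumpCond E u v i →
               LeafCond E u v i → E up u i ≡ true → E vp v i ≡ true →
               Single E u v true
                 (ins vp u i (ins up v i (del vp v i (del up u i E))))
    fail₁    : ∀ i → SingleColour E u v i → ¬ JumpCond E u v i →
               ¬ LeafCond E u v i → Single E u v false E
    fail₂    : ¬ (∃[ i ] SingleColour E u v i) → Single E u v false E

  MixCond : Links → ℕ → ℕ → ℕ → ℕ → ℕ → ℕ → Set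
  MixCond E uc v i j vc u =
    InV M i × InV M j × i ≢ j × E v vc j ≡ true × E u uc i ≡ true
    × L N M E i v ≤∞ L N M E i u × L N M E j u ≤∞ L N M E j v
    × ( (L N M E i u ≢ L N M E i v ⊎ L N M E j u ≢ L N M E j v)
      ⊎ (L N M E i u ≡ L N M E i v × L N M E j u ≡ L N M E j v
         × 0ℤ ℤ.< ((+ u ℤ.- + v) ℤ.* (+ j ℤ.- + i))) )

  data MixSwap (E : Links) (uc v : ℕ) : Bool → Links → Set where
    swap : ∀ i j vc u → MixCond E uc v i j vc u →
           MixSwap E uc v true (ins v uc i (ins u vc j (del v vc j (del u uc i E))))
    fail : ¬ (∃[ i ] ∃[ j ] ∃[ vc ] ∃[ u ] MixCond E uc v i j vc u) →
           MixSwap E uc v false E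

  data Whole (E : Links) (u v : ℕ) : Bool → Links → Set where
    byGreedy  : ∀ {E'} → Greedy E u v true E' → Whole E u v true E'
    bySingle  : ∀ {E₁ E'} → Greedy E u v false E₁ → Single E u v true E' →
                Whole E u v true E'
    byMixSwap : ∀ {E₁ E₂ b E'} → Greedy E u v false E₁ → Single E u v false E₂ →
                MixSwap E u v b E' → Whole E u v b E'

module Submission where

-- Every successful step edits the link set by a few single-link insertions
-- and deletions.  We first show that |E| and S are weighted link counts, which
-- an insertion (deletion) changes by the weight of that link.  Next, depths:
-- L_i is a bounded search over k-hop reachability, and since the reached set
-- stops growing before N hops, a "reachability transfer" from E to E' gives
-- L'_i(E') ≤ L'_i(E) pointwise; moving a node under a no-deeper parent is such a
-- transfer.  Greedy then adds a link, so -|E| drops.  Jump, LeafSwap and MixSwap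
-- keep |E|, transfer reachability (LeafSwap up to swapping u and v) and make
-- some node strictly shallower, so Y drops -- except a MixSwap between equally
-- deep parents, which keeps every depth while S grows by (u-v)(j-i) > 0.  A
-- failing Whole leaves E unchanged; lemma5 is the resulting case analysis.

open import Defs
open import Data.Nat using (ℕ; zero; suc; _+_; _*_; _∸_; _≤_; _<_; _≡ᵇ_; z≤n; s≤s)
open import Data.Nat.Properties
import Data.Nat.Tactic.RingSolver as ℕ-Solver
open import Data.Bool using (Bool; true; false; _∧_; _∨_; not; if_then_else_)
open import Data.Bool.Properties using (∨-identityʳ; ∧-identityʳ; T-≡)
open import Data.Integer as ℤ using (ℤ; 0ℤ; 1ℤ; +≤+)
import Data.Integer.Properties as ℤP
open import Data.Integer.Tactic.RingSolver as ℤ-Solver using ()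
open import Data.Product using (∃-syntax; _×_; _,_; proj₁; proj₂)
open import Data.Sum using (_⊎_; inj₁; inj₂)
open import Data.Empty using (⊥; ⊥-elim)
open import Function using (_∘_; Equivalence)
open import Relation.Nullary using (¬_; yes; no)
open import Relation.Binary.PropositionalEquality

open Equivalence using (to; from)

≡ᵇ-true : ∀ m n → (m ≡ᵇ n) ≡ true → m ≡ n
≡ᵇ-true m n e = ≡ᵇ⇒≡ m n (from T-≡ e)

≡ᵇ-refl : ∀ m → (m ≡ᵇ m) ≡ true
≡ᵇ-refl m = to T-≡ (≡⇒≡ᵇ m m refl)

≡ᵇ-false : ∀ m n → m ≢ n → (m ≡ᵇ n) ≡ false
≡ᵇ-false m n m≢n with m ≡ᵇ n in eq
... | false = refl
... | true  = ⊥-elim (m≢n (≡ᵇ-true m n eq))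

∨-introˡ : ∀ {a} b → a ≡ true → (a ∨ b) ≡ true
∨-introˡ b refl = refl

∨-introʳ : ∀ a {b} → b ≡ true → (a ∨ b) ≡ true
∨-introʳ true  refl = refl
∨-introʳ false refl = refl

∨-elim : ∀ a b → (a ∨ b) ≡ true → a ≡ true ⊎ b ≡ true
∨-elim true  b _ = inj₁ refl
∨-elim false b e = inj₂ e

∧-intro : ∀ {a b} → a ≡ true → b ≡ true → (a ∧ b) ≡ true
∧-intro refl refl = refl

∧-elim : ∀ a b → (a ∧ b) ≡ true → a ≡ true × b ≡ true
∧-elim true true _ = refl , refl

true≢false : true ≢ false
true≢false ()

sameLink : ℕ → ℕ → ℕ → ℕ → ℕ → ℕ → Bool
sameLink a b c x y z = (a ≡ᵇ x) ∧ ((b ≡ᵇ y) ∧ (c ≡ᵇ z))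

sameLink-true : ∀ a b c x y z → sameLink a b c x y z ≡ true → a ≡ x × b ≡ y × c ≡ z
sameLink-true a b c x y z e with ∧-elim (a ≡ᵇ x) _ e
... | ex , e′ with ∧-elim (b ≡ᵇ y) _ e′
...   | ey , ez = ≡ᵇ-true a x ex , ≡ᵇ-true b y ey , ≡ᵇ-true c z ez

sameLink-refl : ∀ a b c → sameLink a b c a b c ≡ true
sameLink-refl a b c rewrite ≡ᵇ-refl a | ≡ᵇ-refl b | ≡ᵇ-refl c = refl

sameLink-false : ∀ a b c x y z → ¬ (a ≡ x × b ≡ y × c ≡ z) → sameLink a b c x y z ≡ false
sameLink-false a b c x y z ne with sameLink a b c x y z in eq
... | false = refl
... | true  = ⊥-elim (ne (sameLink-true a b c x y z eq))

ins-keep : ∀ x y z (G : Links) a b c → G a b c ≡ true → ins x y z G a b c ≡ true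
ins-keep x y z G a b c e = ∨-introˡ _ e

ins-hit : ∀ x y z (G : Links) → ins x y z G x y z ≡ true
ins-hit x y z G = ∨-introʳ (G x y z) (sameLink-refl x y z)

ins-inv : ∀ x y z (G : Links) a b c → ins x y z G a b c ≡ true →
          G a b c ≡ true ⊎ (x ≡ a × y ≡ b × z ≡ c)
ins-inv x y z G a b c e with ∨-elim (G a b c) _ e
... | inj₁ e′ = inj₁ e′
... | inj₂ e′ = inj₂ (sameLink-true x y z a b c e′)

ins-absent : ∀ x y z (G : Links) a b c → G a b c ≡ false → ¬ (x ≡ a × y ≡ b × z ≡ c) →
             ins x y z G a b c ≡ false
ins-absent x y z G a b c e ne rewrite e | sameLink-false x y z a b c ne = refl

del-keep : ∀ x y z (G : Links) a b c → G a b c ≡ true → ¬ (x ≡ a × y ≡ b × z ≡ c) →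
           del x y z G a b c ≡ true
del-keep x y z G a b c e ne rewrite e | sameLink-false x y z a b c ne = refl

del-inv : ∀ x y z (G : Links) a b c → del x y z G a b c ≡ true →
          G a b c ≡ true × ¬ (x ≡ a × y ≡ b × z ≡ c)
del-inv x y z G a b c e with G a b c | sameLink x y z a b c in es
... | true | false = refl , λ { (refl , refl , refl) → true≢false (trans (sym (sameLink-refl x y z)) es) }

del-absent : ∀ x y z (G : Links) a b c → G a b c ≡ false → del x y z G a b c ≡ false
del-absent x y z G a b c e rewrite e = refl

ins-other : ∀ x y z (G : Links) a b c → z ≢ c → ins x y z G a b c ≡ G a b c
ins-other x y z G a b c ne
  rewrite sameLink-false x y z a b c (λ (_ , _ , e) → ne e) = ∨-identityʳ (G a b c)

del-other : ∀ x y z (G : Links) a b c → z ≢ c → del x y z G a b c ≡ G a b c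
del-other x y z G a b c ne
  rewrite sameLink-false x y z a b c (λ (_ , _ , e) → ne e) = ∧-identityʳ (G a b c)

OnlyParent : Links → ℕ → ℕ → ℕ → Set
OnlyParent G c i p = ∀ a → G a c i ≡ true → a ≡ p

OnlyParent-del : ∀ x y z G c i p → OnlyParent G c i p → OnlyParent (del x y z G) c i p
OnlyParent-del x y z G c i p only a e = only a (proj₁ (del-inv x y z G a c i e))

orphaned : ∀ G c i p → OnlyParent G c i p → ∀ a → del p c i G a c i ≡ false
orphaned G c i p only a with G a c i in e
... | false = refl
... | true with only a e
...   | refl rewrite sameLink-refl a c i = refl

InV-empty : ∀ {x} → ¬ InV 0 x
InV-empty (p , q) = <⇒≱ p q

InV-suc : ∀ {n x} → InV n x → InV (suc n) x
InV-suc (p , q) = p , m≤n⇒m≤1+n q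

InV-top : ∀ n → InV (suc n) (suc n)
InV-top n = s≤s z≤n , ≤-refl

InV-split : ∀ {n x} → InV (suc n) x → InV n x ⊎ x ≡ suc n
InV-split (p , q) with m≤n⇒m<n∨m≡n q
... | inj₁ (s≤s q′) = inj₁ (p , q′)
... | inj₂ e       = inj₂ e

InV-below : ∀ {n x} → InV n x → x ≢ suc n
InV-below (_ , q) refl = 1+n≰n q

+-interchange : ∀ a b c d → (a + b) + (c + d) ≡ (a + c) + (b + d)
+-interchange = ℕ-Solver.solve-∀

+-swapLast : ∀ s a b → s + a + b ≡ s + b + a
+-swapLast = ℕ-Solver.solve-∀

sumTo-cong : ∀ n {f g : ℕ → ℕ} → (∀ x → InV n x → f x ≡ g x) → sumTo n f ≡ sumTo n g
sumTo-cong zero    h = refl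
sumTo-cong (suc n) h = cong₂ _+_ (sumTo-cong n (λ x r → h x (InV-suc r))) (h (suc n) (InV-top n))

sumTo-mono : ∀ n {f g : ℕ → ℕ} → (∀ x → InV n x → f x ≤ g x) → sumTo n f ≤ sumTo n g
sumTo-mono zero    h = z≤n
sumTo-mono (suc n) h = +-mono-≤ (sumTo-mono n (λ x r → h x (InV-suc r))) (h (suc n) (InV-top n))

sumTo-strict : ∀ n {f g : ℕ → ℕ} → (∀ x → InV n x → f x ≤ g x) →
               ∀ a → InV n a → f a < g a → sumTo n f < sumTo n g
sumTo-strict zero    h a r lt = ⊥-elim (InV-empty r)
sumTo-strict (suc n) h a r lt with InV-split r
... | inj₁ r′   = +-mono-<-≤ (sumTo-strict n (λ x r → h x (InV-suc r)) a r′ lt) (h (suc n) (InV-top n))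
... | inj₂ refl = +-mono-≤-< (sumTo-mono n (λ x r → h x (InV-suc r))) lt

sumTo-eq-pointwise : ∀ n {f g : ℕ → ℕ} → (∀ x → InV n x → f x ≤ g x) → sumTo n f ≡ sumTo n g →
                     ∀ x → InV n x → f x ≡ g x
sumTo-eq-pointwise n h e x r with m≤n⇒m<n∨m≡n (h x r)
... | inj₁ lt = ⊥-elim (<⇒≢ (sumTo-strict n h x r lt) e)
... | inj₂ eq = eq

sumTo-+ : ∀ n (f g : ℕ → ℕ) → sumTo n (λ x → f x + g x) ≡ sumTo n f + sumTo n g
sumTo-+ zero    f g = refl
sumTo-+ (suc n) f g rewrite sumTo-+ n f g = +-interchange (sumTo n f) (sumTo n g) (f (suc n)) (g (suc n))

sumTo-* : ∀ n k (f : ℕ → ℕ) → sumTo n (λ x → k * f x) ≡ k * sumTo n f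
sumTo-* zero    k f = sym (*-zeroʳ k)
sumTo-* (suc n) k f rewrite sumTo-* n k f = sym (*-distribˡ-+ k (sumTo n f) (f (suc n)))

sumTo-zero : ∀ n {f : ℕ → ℕ} → (∀ x → InV n x → f x ≡ 0) → sumTo n f ≡ 0
sumTo-zero zero    h = refl
sumTo-zero (suc n) h = cong₂ _+_ (sumTo-zero n (λ x r → h x (InV-suc r))) (h (suc n) (InV-top n))

sumTo-swap : ∀ n m (f : ℕ → ℕ → ℕ) →
             sumTo n (λ a → sumTo m (λ b → f a b)) ≡ sumTo m (λ b → sumTo n (λ a → f a b))
sumTo-swap zero    m f = sym (sumTo-zero m (λ _ _ → refl))
sumTo-swap (suc n) m f rewrite sumTo-swap n m f =
  sym (sumTo-+ m (λ b → sumTo n (λ a → f a b)) (λ b → f (suc n) b))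

sumTo-term : ∀ n (f : ℕ → ℕ) a → InV n a → f a ≤ sumTo n f
sumTo-term zero    f a r = ⊥-elim (InV-empty r)
sumTo-term (suc n) f a r with InV-split r
... | inj₁ r′   = ≤-trans (sumTo-term n f a r′) (m≤m+n _ _)
... | inj₂ refl = m≤n+m _ _

sumTo-zero-inv : ∀ n {f : ℕ → ℕ} → sumTo n f ≡ 0 → ∀ x → InV n x → f x ≡ 0
sumTo-zero-inv n {f} e x r = n≤0⇒n≡0 (subst (f x ≤_) e (sumTo-term n f x r))

sumTo-pos : ∀ n {f : ℕ → ℕ} → 1 ≤ sumTo n f → ∃[ x ] (InV n x × 1 ≤ f x)
sumTo-pos zero    ()
sumTo-pos (suc n) {f} h with f (suc n) in eq
... | suc k = suc n , InV-top n , subst (1 ≤_) (sym eq) (s≤s z≤n)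
... | zero with sumTo-pos n (subst (1 ≤_) (+-identityʳ _) h)
...   | x , r , l = x , InV-suc r , l

sumTo-bound : ∀ n {f : ℕ → ℕ} → (∀ x → f x ≤ 1) → sumTo n f ≤ n
sumTo-bound zero    h = z≤n
sumTo-bound (suc n) {f} h = subst (sumTo n f + f (suc n) ≤_) (+-comm n 1) (+-mono-≤ (sumTo-bound n h) (h (suc n)))

dropAt : ℕ → (ℕ → ℕ) → ℕ → ℕ
dropAt a f x = if x ≡ᵇ a then 0 else f x

dropAt-other : ∀ a (f : ℕ → ℕ) x → x ≢ a → dropAt a f x ≡ f x
dropAt-other a f x ne rewrite ≡ᵇ-false x a ne = refl

sumTo-dropAt : ∀ n a (f : ℕ → ℕ) → InV n a → sumTo n f ≡ sumTo n (dropAt a f) + f a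
sumTo-dropAt zero    a f r = ⊥-elim (InV-empty r)
sumTo-dropAt (suc n) a f r with InV-split r
... | inj₁ r′ = begin
  sumTo n f + f (suc n)                            ≡⟨ cong (_+ f (suc n)) (sumTo-dropAt n a f r′) ⟩
  sumTo n (dropAt a f) + f a + f (suc n)           ≡⟨ +-swapLast _ (f a) (f (suc n)) ⟩
  sumTo n (dropAt a f) + f (suc n) + f a           ≡⟨ cong (λ t → sumTo n (dropAt a f) + t + f a)
                                                        (sym (dropAt-other a f (suc n) (≢-sym (InV-below r′)))) ⟩
  sumTo n (dropAt a f) + dropAt a f (suc n) + f a  ∎
  where open ≡-Reasoning
... | inj₂ refl rewrite ≡ᵇ-refl n =
  cong (_+ f (suc n)) (trans (sumTo-cong n (λ x r → sym (dropAt-other (suc n) f x (InV-below r))))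
                             (sym (+-identityʳ _)))

sumTo-delta : ∀ n x (f : ℕ → ℕ) → InV n x → sumTo n (λ a → count (x ≡ᵇ a) * f a) ≡ f x
sumTo-delta n x f r = begin
  sumTo n g                         ≡⟨ sumTo-dropAt n x g r ⟩
  sumTo n (dropAt x g) + g x        ≡⟨ cong₂ _+_ (sumTo-zero n (λ a _ → dropped a)) (cong (λ b → count b * f x) (≡ᵇ-refl x)) ⟩
  0 + (f x + 0)                     ≡⟨ +-identityʳ (f x) ⟩
  f x                               ∎
  where
  open ≡-Reasoning
  g : ℕ → ℕ
  g a = count (x ≡ᵇ a) * f a
  dropped : ∀ a → dropAt x g a ≡ 0
  dropped a with a ≟ x
  ... | yes refl rewrite ≡ᵇ-refl a = refl
  ... | no a≢x rewrite ≡ᵇ-false a x a≢x | ≡ᵇ-false x a (≢-sym a≢x) = refl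

transpose : ℕ → ℕ → ℕ → ℕ
transpose u v x = if x ≡ᵇ u then v else (if x ≡ᵇ v then u else x)

transpose-u : ∀ u v → transpose u v u ≡ v
transpose-u u v rewrite ≡ᵇ-refl u = refl

transpose-v : ∀ u v → u ≢ v → transpose u v v ≡ u
transpose-v u v ne rewrite ≡ᵇ-false v u (≢-sym ne) | ≡ᵇ-refl v = refl

transpose-other : ∀ u v x → x ≢ u → x ≢ v → transpose u v x ≡ x
transpose-other u v x n₁ n₂ rewrite ≡ᵇ-false x u n₁ | ≡ᵇ-false x v n₂ = refl

transpose-InV : ∀ n u v x → InV n u → InV n v → InV n x → InV n (transpose u v x)
transpose-InV n u v x ru rv rx with x ≟ u
... | yes refl rewrite transpose-u u v = rv
... | no n₁ with x ≟ v
...   | yes refl rewrite transpose-v u v (≢-sym n₁) = ru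
...   | no n₂ rewrite transpose-other u v x n₁ n₂ = rx

sumTo-dropTwo : ∀ n u v (g : ℕ → ℕ) → InV n u → InV n v → u ≢ v →
                sumTo n g ≡ sumTo n (dropAt v (dropAt u g)) + g v + g u
sumTo-dropTwo n u v g ru rv u≢v =
  trans (sumTo-dropAt n u g ru)
        (cong (_+ g u) (trans (sumTo-dropAt n v (dropAt u g) rv)
                              (cong (sumTo n (dropAt v (dropAt u g)) +_) (dropAt-other u g v (≢-sym u≢v)))))

sumTo-transpose : ∀ n u v (f : ℕ → ℕ) → InV n u → InV n v → u ≢ v →
                  sumTo n (f ∘ transpose u v) ≡ sumTo n f
sumTo-transpose n u v f ru rv u≢v = begin
  sumTo n (f ∘ τ)                                           ≡⟨ sumTo-dropTwo n u v (f ∘ τ) ru rv u≢v ⟩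
  sumTo n (dropAt v (dropAt u (f ∘ τ))) + f (τ v) + f (τ u) ≡⟨ cong (λ s → s + f (τ v) + f (τ u)) (sumTo-cong n (λ x _ → agree x)) ⟩
  sumTo n (dropAt v (dropAt u f)) + f (τ v) + f (τ u)       ≡⟨ cong₂ (λ s t → sumTo n (dropAt v (dropAt u f)) + s + t)
                                                                  (cong f (transpose-v u v u≢v)) (cong f (transpose-u u v)) ⟩
  sumTo n (dropAt v (dropAt u f)) + f u + f v               ≡⟨ +-swapLast _ (f u) (f v) ⟩
  sumTo n (dropAt v (dropAt u f)) + f v + f u               ≡⟨ sym (sumTo-dropTwo n u v f ru rv u≢v) ⟩
  sumTo n f                                                 ∎
  where
  open ≡-Reasoning
  τ : ℕ → ℕ
  τ = transpose u v
  agree : ∀ x → dropAt v (dropAt u (f ∘ τ)) x ≡ dropAt v (dropAt u f) x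
  agree x with x ≟ v
  ... | yes refl rewrite ≡ᵇ-refl x = refl
  ... | no x≢v with x ≟ u
  ...   | yes refl rewrite ≡ᵇ-false x v x≢v | ≡ᵇ-refl x = refl
  ...   | no x≢u rewrite ≡ᵇ-false x v x≢v | ≡ᵇ-false x u x≢u = refl

-- Weighted link counts Φ_w(G) = Σ_{a,b ∈ V, c ∈ R} w(a,b,c)·[(a,b) ∈ G_c].
-- |E| is Φ_1 and S is Φ_{(a,b,c) ↦ a·c}; inserting a new link adds its weight,
-- deleting a present link removes it.

count-ins : ∀ x y z (G : Links) a b c → G x y z ≡ false →
            count (ins x y z G a b c) ≡ count (G a b c) + count (sameLink x y z a b c)
count-ins x y z G a b c absent with G a b c in eg | sameLink x y z a b c in es
... | false | _     = refl
... | true  | false = refl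
... | true  | true with sameLink-true x y z a b c es
...   | refl , refl , refl = ⊥-elim (true≢false (trans (sym eg) absent))

count-del : ∀ x y z (G : Links) a b c → G x y z ≡ true →
            count (del x y z G a b c) + count (sameLink x y z a b c) ≡ count (G a b c)
count-del x y z G a b c present with G a b c in eg | sameLink x y z a b c in es
... | true  | true  = refl
... | true  | false = refl
... | false | false = refl
... | false | true with sameLink-true x y z a b c es
...   | refl , refl , refl = ⊥-elim (true≢false (trans (sym present) eg))

count-sameLink : ∀ w x y z a b c →
                 w * count (sameLink x y z a b c) ≡ count (x ≡ᵇ a) * (count (y ≡ᵇ b) * (count (z ≡ᵇ c) * w))
count-sameLink w x y z a b c with x ≡ᵇ a | y ≡ᵇ b | z ≡ᵇ c
... | false | _     | _     = *-zeroʳ w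
... | true  | false | _     = *-zeroʳ w
... | true  | true  | false = *-zeroʳ w
... | true  | true  | true  = trans (*-identityʳ w)
                                   (sym (trans (*-identityˡ _) (trans (*-identityˡ _) (*-identityˡ w))))

module _ (N M : ℕ) where

  Σ3 : (ℕ → ℕ → ℕ → ℕ) → ℕ
  Σ3 F = sumTo N (λ a → sumTo N (λ b → sumTo M (λ c → F a b c)))

  Σ3-cong : ∀ {F G} → (∀ a b c → F a b c ≡ G a b c) → Σ3 F ≡ Σ3 G
  Σ3-cong h = sumTo-cong N (λ a _ → sumTo-cong N (λ b _ → sumTo-cong M (λ c _ → h a b c)))

  Σ3-+ : ∀ F G → Σ3 (λ a b c → F a b c + G a b c) ≡ Σ3 F + Σ3 G
  Σ3-+ F G = trans (sumTo-cong N (λ a _ → trans (sumTo-cong N (λ b _ → sumTo-+ M (F a b) (G a b)))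
                                                 (sumTo-+ N _ _)))
                   (sumTo-+ N _ _)

  Σ3-sameLink : ∀ (w : ℕ → ℕ → ℕ → ℕ) x y z → InV N x → InV N y → InV M z →
                Σ3 (λ a b c → w a b c * count (sameLink x y z a b c)) ≡ w x y z
  Σ3-sameLink w x y z rx ry rz = begin
    Σ3 (λ a b c → w a b c * count (sameLink x y z a b c))  ≡⟨ Σ3-cong (λ a b c → count-sameLink (w a b c) x y z a b c) ⟩
    Σ3 (λ a b c → δ x a * (δ y b * (δ z c * w a b c)))     ≡⟨ sumTo-cong N (λ a _ → sumTo-cong N (λ b _ → pickZ a b)) ⟩
    sumTo N (λ a → sumTo N (λ b → δ x a * (δ y b * w a b z))) ≡⟨ sumTo-cong N (λ a _ → pickY a) ⟩
    sumTo N (λ a → δ x a * w a y z)                        ≡⟨ sumTo-delta N x (λ a → w a y z) rx ⟩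
    w x y z                                                ∎
    where
    open ≡-Reasoning
    δ : ℕ → ℕ → ℕ
    δ x a = count (x ≡ᵇ a)
    pickZ : ∀ a b → sumTo M (λ c → δ x a * (δ y b * (δ z c * w a b c))) ≡ δ x a * (δ y b * w a b z)
    pickZ a b = trans (sumTo-* M (δ x a) _)
                  (cong (δ x a *_) (trans (sumTo-* M (δ y b) _) (cong (δ y b *_) (sumTo-delta M z (w a b) rz))))
    pickY : ∀ a → sumTo N (λ b → δ x a * (δ y b * w a b z)) ≡ δ x a * w a y z
    pickY a = trans (sumTo-* N (δ x a) _) (cong (δ x a *_) (sumTo-delta N y (λ b → w a b z) ry))

  Φ : (ℕ → ℕ → ℕ → ℕ) → Links → ℕ
  Φ w G = Σ3 (λ a b c → w a b c * count (G a b c))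

  Φ-ins : ∀ w x y z (G : Links) → G x y z ≡ false → InV N x → InV N y → InV M z →
          Φ w (ins x y z G) ≡ Φ w G + w x y z
  Φ-ins w x y z G absent rx ry rz =
    trans (Σ3-cong (λ a b c → trans (cong (w a b c *_) (count-ins x y z G a b c absent)) (*-distribˡ-+ (w a b c) _ _)))
          (trans (Σ3-+ _ _) (cong (Φ w G +_) (Σ3-sameLink w x y z rx ry rz)))

  Φ-del : ∀ w x y z (G : Links) → G x y z ≡ true → InV N x → InV N y → InV M z →
          Φ w (del x y z G) + w x y z ≡ Φ w G
  Φ-del w x y z G present rx ry rz =
    trans (cong (Φ w (del x y z G) +_) (sym (Σ3-sameLink w x y z rx ry rz)))
      (trans (sym (Σ3-+ _ _))
        (Σ3-cong (λ a b c → trans (sym (*-distribˡ-+ (w a b c) _ _)) (cong (w a b c *_) (count-del x y z G a b c present)))))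

  size-Φ : ∀ E → size N M E ≡ Φ (λ _ _ _ → 1) E
  size-Φ E = Σ3-cong (λ a b c → sym (+-identityʳ _))

  S-Φ : ∀ E → S N M E ≡ Φ (λ a b c → a * c) E
  S-Φ E = sumTo-cong N (λ a _ → begin
      a * Dw N M E a                                                   ≡⟨ sym (sumTo-* M a _) ⟩
      sumTo M (λ c → a * (c * sumTo N (λ b → count (E a b c))))        ≡⟨ sumTo-cong M (λ c _ → inner a c) ⟩
      sumTo M (λ c → sumTo N (λ b → a * c * count (E a b c)))          ≡⟨ sumTo-swap M N (λ c b → a * c * count (E a b c)) ⟩
      sumTo N (λ b → sumTo M (λ c → a * c * count (E a b c)))          ∎)
    where
    open ≡-Reasoning
    inner : ∀ a c → a * (c * sumTo N (λ b → count (E a b c))) ≡ sumTo N (λ b → a * c * count (E a b c))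
    inner a c = trans (sym (*-assoc a c _))
                      (sym (sumTo-* N (a * c) (λ b → count (E a b c))))

  size-ins : ∀ x y z (G : Links) → G x y z ≡ false → InV N x → InV N y → InV M z →
             size N M (ins x y z G) ≡ suc (size N M G)
  size-ins x y z G absent rx ry rz =
    trans (size-Φ _) (trans (Φ-ins _ x y z G absent rx ry rz) (trans (+-comm _ 1) (cong suc (sym (size-Φ G)))))

  size-del : ∀ x y z (G : Links) → G x y z ≡ true → InV N x → InV N y → InV M z →
             suc (size N M (del x y z G)) ≡ size N M G
  size-del x y z G present rx ry rz =
    trans (cong suc (size-Φ _)) (trans (+-comm 1 _) (trans (Φ-del _ x y z G present rx ry rz) (sym (size-Φ G))))

_≺_ : ℕ → ℕ∞ → Set
b ≺ x = ∀ l → x ≡ fin l → b < l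

≤∞-refl : ∀ {x} → x ≤∞ x
≤∞-refl {fin n} = fin≤fin ≤-refl
≤∞-refl {∞}     = x≤∞

≤∞-fin : ∀ {x m} → x ≤∞ fin m → ∃[ a ] (x ≡ fin a × a ≤ m)
≤∞-fin (fin≤fin {a} le) = a , refl , le

<∞-fin : ∀ {x y} → x <∞ y → ∃[ a ] (x ≡ fin a × a ≺ y)
<∞-fin (fin<fin {a} lt) = a , refl , λ { l refl → lt }
<∞-fin (fin<∞ {a})      = a , refl , λ l ()

<∞⇒≤∞ : ∀ {x y} → x <∞ y → x ≤∞ y
<∞⇒≤∞ (fin<fin lt) = fin≤fin (<⇒≤ lt)
<∞⇒≤∞ fin<∞       = x≤∞

suc∞<∞-fin : ∀ x {y} → suc∞ x <∞ y → ∃[ a ] (x ≡ fin a × suc a ≺ y)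
suc∞<∞-fin (fin a) (fin<fin lt) = a , refl , λ { l refl → lt }
suc∞<∞-fin (fin a) fin<∞        = a , refl , λ l ()
suc∞<∞-fin ∞       ()

≤∞-≢-fin : ∀ {x y} → x ≤∞ y → y ≢ x → ∃[ b ] (x ≡ fin b × b ≺ y)
≤∞-≢-fin (fin≤fin {b} le) ne = b , refl , λ { m refl → ≤∧≢⇒< le (λ e → ne (cong fin (sym e))) }
≤∞-≢-fin {fin b} x≤∞ ne = b , refl , λ m ()
≤∞-≢-fin {∞}     x≤∞ ne = ⊥-elim (ne refl)

search-fin : ∀ p n l → search p n ≡ fin l → p l ≡ true × l < n
search-fin p zero    l ()
search-fin p (suc n) l e with p 0 in e0
search-fin p (suc n) .0 refl | true = e0 , s≤s z≤n
... | false with search (λ k → p (suc k)) n in e1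
...   | fin l′ with e
...     | refl with search-fin (λ k → p (suc k)) n l′ e1
...       | pl , l<n = pl , s≤s l<n
search-fin p (suc n) l () | false | ∞

search-le : ∀ p n k → p k ≡ true → k < n → ∃[ l ] (search p n ≡ fin l × l ≤ k)
search-le p (suc n) k pk lt with p 0 in e0
... | true = 0 , refl , z≤n
search-le p (suc n) zero    pk lt       | false = ⊥-elim (true≢false (trans (sym pk) e0))
search-le p (suc n) (suc k) pk (s≤s lt) | false with search-le (λ k → p (suc k)) n k pk lt
... | l , e , le rewrite e = suc l , refl , s≤s le

search-cong : ∀ {p q : ℕ → Bool} n → (∀ k → p k ≡ q k) → search p n ≡ search q n
search-cong zero    h = refl
search-cong {p} {q} (suc n) h
  rewrite h 0 | search-cong {λ k → p (suc k)} {λ k → q (suc k)} n (λ k → h (suc k)) = refl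

anyTo-intro : ∀ n (p : ℕ → Bool) a → p a ≡ true → InV n a → anyTo n p ≡ true
anyTo-intro zero    p a e r = ⊥-elim (InV-empty r)
anyTo-intro (suc n) p a e r with InV-split r
... | inj₁ r′   = ∨-introˡ _ (anyTo-intro n p a e r′)
... | inj₂ refl = ∨-introʳ _ e

anyTo-elim : ∀ n (p : ℕ → Bool) → anyTo n p ≡ true → ∃[ a ] (InV n a × p a ≡ true)
anyTo-elim zero    p ()
anyTo-elim (suc n) p e with ∨-elim (anyTo n p) _ e
... | inj₂ e′ = suc n , InV-top n , e′
... | inj₁ e′ with anyTo-elim n p e′
...   | a , r , pa = a , InV-suc r , pa

anyTo-cong : ∀ n {p q : ℕ → Bool} → (∀ a → InV n a → p a ≡ q a) → anyTo n p ≡ anyTo n q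
anyTo-cong zero    h = refl
anyTo-cong (suc n) h = cong₂ _∨_ (anyTo-cong n (λ a r → h a (InV-suc r))) (h (suc n) (InV-top n))

count-mono : ∀ {a b} → (a ≡ true → b ≡ true) → count a ≤ count b
count-mono {false} h = z≤n
count-mono {true}  h rewrite h refl = ≤-refl

count-injective : ∀ {a b} → count a ≡ count b → a ≡ b
count-injective {false} {false} _ = refl
count-injective {true}  {true}  _ = refl

count≤1 : ∀ b → count b ≤ 1
count≤1 true  = ≤-refl
count≤1 false = z≤n

module Depth (N M : ℕ) (E : Links) (i : ℕ) where

  Reach : ℕ → ℕ → Bool
  Reach k w = reach N M E i k w

  Reach-root : Reach 0 i ≡ true
  Reach-root = ≡ᵇ-refl i

  Reach-zero : ∀ w → Reach 0 w ≡ true → w ≡ i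
  Reach-zero w e = ≡ᵇ-true w i e

  Reach-step : ∀ k w → Reach k w ≡ true → Reach (suc k) w ≡ true
  Reach-step k w e = ∨-introˡ _ e

  Reach-mono : ∀ {k k′} w → k ≤ k′ → Reach k w ≡ true → Reach k′ w ≡ true
  Reach-mono {k} {k′} w le e with m≤n⇒m<n∨m≡n le
  ... | inj₂ refl = e
  Reach-mono {k} {suc k′} w le e | inj₁ (s≤s lt) = Reach-step k′ w (Reach-mono w lt e)

  Reach-edge : ∀ k a w → Reach k a ≡ true → E a w i ≡ true → InV N a → Reach (suc k) w ≡ true
  Reach-edge k a w ea eaw r =
    ∨-introʳ (Reach k w) (anyTo-intro N (λ a → Reach k a ∧ E a w i) a (∧-intro ea eaw) r)

  Reach-inv : ∀ k w → Reach (suc k) w ≡ true →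
              Reach k w ≡ true ⊎ ∃[ a ] (InV N a × Reach k a ≡ true × E a w i ≡ true)
  Reach-inv k w e with ∨-elim (Reach k w) _ e
  ... | inj₁ e′ = inj₁ e′
  ... | inj₂ e′ with anyTo-elim N _ e′
  ...   | a , r , p with ∧-elim (Reach k a) _ p
  ...     | ra , eaw = inj₂ (a , r , ra , eaw)

  -- Pigeonhole: the number of nodes reached within k hops grows with k, is at
  -- most N, and once it stalls the reached set never changes again.
  reachCount : ℕ → ℕ
  reachCount k = sumTo N (λ w → count (Reach k w))

  Stable : ℕ → Set
  Stable k = ∀ w → InV N w → Reach (suc k) w ≡ Reach k w

  stall⇒Stable : ∀ k → reachCount (suc k) ≡ reachCount k → Stable k
  stall⇒Stable k e w r =
    count-injective (sym (sumTo-eq-pointwise N (λ w _ → count-mono (Reach-step k w)) (sym e) w r))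

  Stable-suc : ∀ k → Stable k → Stable (suc k)
  Stable-suc k st w r =
    trans (cong (Reach (suc k) w ∨_) (anyTo-cong N (λ a ra → cong (_∧ E a w i) (st a ra))))
          (absorb (Reach k w) (anyTo N (λ a → Reach k a ∧ E a w i)))
    where
    absorb : ∀ a b → ((a ∨ b) ∨ b) ≡ (a ∨ b)
    absorb true  b     = refl
    absorb false true  = refl
    absorb false false = refl

  Stable-forever : ∀ k → Stable k → ∀ m w → InV N w → Reach (m + k) w ≡ Reach k w
  Stable-forever k st zero    w r = refl
  Stable-forever k st (suc m) w r =
    trans (stableAt m w r) (Stable-forever k st m w r)
    where
    stableAt : ∀ m → Stable (m + k)
    stableAt zero    = st
    stableAt (suc m) = Stable-suc (m + k) (stableAt m)

  growth : InV N i → ∀ t → (∃[ k ] (k < t × reachCount (suc k) ≡ reachCount k)) ⊎ (suc t ≤ reachCount t)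
  growth ri zero = inj₂ (subst (λ b → count b ≤ reachCount 0) Reach-root (sumTo-term N (λ w → count (Reach 0 w)) i ri))
  growth ri (suc t) with growth ri t
  ... | inj₁ (k , lt , e) = inj₁ (k , m≤n⇒m≤1+n lt , e)
  ... | inj₂ h with m≤n⇒m<n∨m≡n (sumTo-mono N (λ w _ → count-mono (Reach-step t w)))
  ...   | inj₁ lt = inj₂ (≤-trans (s≤s h) lt)
  ...   | inj₂ e  = inj₁ (t , ≤-refl , sym e)

  Reach-below-N : InV N i → ∀ k w → InV N w → Reach k w ≡ true →
                  ∃[ k′ ] (k′ < N × k′ ≤ k × Reach k′ w ≡ true)
  Reach-below-N ri k w rw e with k <? N
  ... | yes k<N = k , k<N , ≤-refl , e
  ... | no k≮N with growth ri N
  ...   | inj₂ h = ⊥-elim (<⇒≱ h (sumTo-bound N (λ w → count≤1 _)))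
  ...   | inj₁ (k₀ , k₀<N , stall) =
    k₀ , k₀<N , k₀≤k , trans (sym (Stable-forever k₀ (stall⇒Stable k₀ stall) (k ∸ k₀) w rw))
                             (trans (cong (λ t → Reach t w) (m∸n+n≡m k₀≤k)) e)
    where
    k₀≤k : k₀ ≤ k
    k₀≤k = <⇒≤ (<-≤-trans k₀<N (≮⇒≥ k≮N))

  L-fin : ∀ w l → L N M E i w ≡ fin l → Reach l w ≡ true × l < N
  L-fin w l e = search-fin (λ k → Reach k w) N l e

  Reach⇒L : InV N i → ∀ k w → InV N w → Reach k w ≡ true → ∃[ l ] (L N M E i w ≡ fin l × l ≤ k)
  Reach⇒L ri k w rw e with Reach-below-N ri k w rw e
  ... | k′ , k′<N , k′≤k , e′ with search-le (λ k → Reach k w) N k′ e′ k′<N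
  ...   | l , eq , l≤k′ = l , eq , ≤-trans l≤k′ k′≤k

  L'-fin : ∀ w l → L N M E i w ≡ fin l → L' N M E i w ≡ l
  L'-fin w l e = trans (cong (λ x → min∞ x N) e) (m≤n⇒m⊓n≡m (<⇒≤ (proj₂ (L-fin w l e))))

  L'-∞ : ∀ w → L N M E i w ≡ ∞ → L' N M E i w ≡ N
  L'-∞ w e = cong (λ x → min∞ x N) e

  L'≤N : ∀ w → L' N M E i w ≤ N
  L'≤N w with L N M E i w
  ... | fin k = m⊓n≤n k N
  ... | ∞     = ≤-refl

  Reach⇒L'≤ : ∀ k w → Reach k w ≡ true → L' N M E i w ≤ k
  Reach⇒L'≤ k w e with k <? N
  ... | no k≮N = ≤-trans (L'≤N w) (≮⇒≥ k≮N)
  ... | yes k<N with search-le (λ k → Reach k w) N k e k<N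
  ...   | l , eq , l≤k = ≤-trans (≤-reflexive (L'-fin w l eq)) l≤k

  Reach⇒L'<N : InV N i → ∀ k w → InV N w → Reach k w ≡ true → L' N M E i w < N
  Reach⇒L'<N ri k w rw e with Reach⇒L ri k w rw e
  ... | l , eq , _ = subst (_< N) (sym (L'-fin w l eq)) (proj₂ (L-fin w l eq))

  L-view : ∀ w → (∃[ l ] L N M E i w ≡ fin l) ⊎ L N M E i w ≡ ∞
  L-view w with L N M E i w
  ... | fin l = inj₁ (l , refl)
  ... | ∞     = inj₂ refl

  noDeeper-Reach : InV N i → ∀ q p → InV N p → L N M E i q ≤∞ L N M E i p →
                   ∀ k → Reach k p ≡ true → Reach k q ≡ true
  noDeeper-Reach ri q p rp q≤p k e with Reach⇒L ri k p rp e
  ... | m , em , m≤k with ≤∞-fin (subst (L N M E i q ≤∞_) em q≤p)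
  ...   | a , ea , a≤m = Reach-mono q (≤-trans a≤m m≤k) (proj₁ (L-fin q a ea))

  viaParent : ∀ c p → OnlyParent E c i p → c ≢ i →
              ∀ k → Reach k c ≡ true → ∃[ k′ ] (k ≡ suc k′ × Reach k′ p ≡ true)
  viaParent c p onlyP c≢i zero    e = ⊥-elim (c≢i (Reach-zero c e))
  viaParent c p onlyP c≢i (suc k) e with Reach-inv k c e
  ... | inj₂ (a , _ , ra , eac) with onlyP a eac
  ...   | refl = k , refl , ra
  viaParent c p onlyP c≢i (suc k) e | inj₁ e′ with viaParent c p onlyP c≢i k e′
  ...   | k′ , refl , e″ = k , refl , Reach-step k′ p e″

  child-deeper : InV N i → ∀ c p b → OnlyParent E c i p → c ≢ i → InV N p →
                 b ≺ L N M E i p → suc b ≺ L N M E i c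
  child-deeper ri c p b onlyP c≢i rp b≺p l eq with viaParent c p onlyP c≢i l (proj₁ (L-fin c l eq))
  ... | l′ , refl , e with Reach⇒L ri l′ p rp e
  ...   | m , em , m≤l′ = s≤s (≤-trans (b≺p m em) m≤l′)

  child-within : InV N i → ∀ p c → E p c i ≡ true → InV N p → InV N c →
                 ∀ m → L N M E i p ≡ fin m → ∃[ l ] (L N M E i c ≡ fin l × l ≤ suc m)
  child-within ri p c epc rp rc m em = Reach⇒L ri (suc m) c rc (Reach-edge m p c (proj₁ (L-fin p m em)) epc rp)

  shallower-than-parent : InV N i → ∀ p c v a → E p c i ≡ true → InV N p → InV N c →
                          L N M E i v ≡ fin a → suc a ≺ L N M E i c → L N M E i v ≤∞ L N M E i p
  shallower-than-parent ri p c v a epc rp rc ea deeper with L-view p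
  ... | inj₂ ep rewrite ep = x≤∞
  ... | inj₁ (m , em) with child-within ri p c epc rp rc m em
  ...   | l , el , l≤1+m rewrite ea | em = fin≤fin (<⇒≤ (≤-pred (≤-trans (deeper l el) l≤1+m)))

module Compare (N M : ℕ) where

  Transfer : Links → Links → ℕ → ℕ → ℕ → Set
  Transfer E E' c w w′ = ∀ k → reach N M E c k w ≡ true → reach N M E' c k w′ ≡ true

  L'-transfer : ∀ E E' c w w′ → Transfer E E' c w w′ → L' N M E' c w′ ≤ L' N M E c w
  L'-transfer E E' c w w′ T with Depth.L-view N M E c w
  ... | inj₁ (l , eq) = subst (L' N M E' c w′ ≤_) (sym (Depth.L'-fin N M E c w l eq))
                          (Depth.Reach⇒L'≤ N M E' c l w′ (T l (proj₁ (Depth.L-fin N M E c w l eq))))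
  ... | inj₂ eq       = subst (L' N M E' c w′ ≤_) (sym (Depth.L'-∞ N M E c w eq)) (Depth.L'≤N N M E' c w′)

  L'-shallower : ∀ E E' c w w′ b → InV N c → InV N w′ → reach N M E' c b w′ ≡ true →
                 b ≺ L N M E c w → L' N M E' c w′ < L' N M E c w
  L'-shallower E E' c w w′ b rc rw′ e b≺w with Depth.L-view N M E c w
  ... | inj₁ (l , eq) = subst (L' N M E' c w′ <_) (sym (Depth.L'-fin N M E c w l eq))
                          (≤-<-trans (Depth.Reach⇒L'≤ N M E' c b w′ e) (b≺w l eq))
  ... | inj₂ eq       = subst (L' N M E' c w′ <_) (sym (Depth.L'-∞ N M E c w eq))
                          (Depth.Reach⇒L'<N N M E' c rc b w′ rw′ e)

  reach-cong : ∀ E E' c → (∀ a b → E a b c ≡ E' a b c) → ∀ k w → reach N M E c k w ≡ reach N M E' c k w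
  reach-cong E E' c h zero    w = refl
  reach-cong E E' c h (suc k) w =
    cong₂ _∨_ (reach-cong E E' c h k w) (anyTo-cong N (λ a _ → cong₂ _∧_ (reach-cong E E' c h k a) (h a w)))

  L'-cong : ∀ E E' c → (∀ a b → E a b c ≡ E' a b c) → ∀ w → L' N M E' c w ≡ L' N M E c w
  L'-cong E E' c h w = cong (λ x → min∞ x N) (search-cong N (λ k → sym (reach-cong E E' c h k w)))

  reparent : ∀ (G H : Links) (i p q c : ℕ) → InV N q →
             (∀ a b → G a b i ≡ true → b ≢ c → H a b i ≡ true) →
             OnlyParent G c i p →
             H q c i ≡ true →
             (∀ k → (∀ w → reach N M G i k w ≡ true → reach N M H i k w ≡ true) →
                    reach N M G i k p ≡ true → reach N M H i k q ≡ true) →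
             ∀ k w → reach N M G i k w ≡ true → reach N M H i k w ≡ true
  reparent G H i p q c rq keep onlyP newLink parentStep = go
    where
    go : ∀ k w → reach N M G i k w ≡ true → reach N M H i k w ≡ true
    go zero    w e = e
    go (suc k) w e with Depth.Reach-inv N M G i k w e
    ... | inj₁ e′ = Depth.Reach-step N M H i k w (go k w e′)
    ... | inj₂ (a , ra , ea , eaw) with w ≟ c
    ...   | no w≢c = Depth.Reach-edge N M H i k a w (go k a ea) (keep a w eaw w≢c) ra
    ...   | yes refl with onlyP a eaw
    ...     | refl = Depth.Reach-edge N M H i k q w (parentStep k (go k) ea) newLink rq

  depthSum : Links → ℕ → ℕ
  depthSum E c = sumTo N (λ w → L' N M E c w)

  Y-colours : ∀ E → Y N M E ≡ sumTo M (depthSum E)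
  Y-colours E = sumTo-swap N M (λ w c → L' N M E c w)

  Y-decrease : ∀ E E' i → InV M i → (∀ c → InV M c → depthSum E' c ≤ depthSum E c) →
               depthSum E' i < depthSum E i → Y N M E' < Y N M E
  Y-decrease E E' i ri allLe iLt =
    subst₂ _<_ (sym (Y-colours E')) (sym (Y-colours E)) (sumTo-strict M allLe i ri iLt)

  Y-same : ∀ E E' → (∀ c w → InV M c → InV N w → L' N M E' c w ≡ L' N M E c w) → Y N M E' ≡ Y N M E
  Y-same E E' h = sumTo-cong N (λ w rw → sumTo-cong M (λ c rc → h c w rc rw))

  depthSum-untouched : ∀ E E' c → (∀ a b → E a b c ≡ E' a b c) → depthSum E' c ≤ depthSum E c
  depthSum-untouched E E' c h = ≤-reflexive (sumTo-cong N (λ w _ → L'-cong E E' c h w))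

  -- Depth sums do not grow under a transfer along π, where π permutes the nodes
  -- as far as depth sums are concerned (π is the identity or a transposition).
  depthSum-transfer : ∀ E E' c (π : ℕ → ℕ) → sumTo N (λ w → L' N M E' c (π w)) ≡ depthSum E' c →
                      (∀ w → Transfer E E' c w (π w)) → depthSum E' c ≤ depthSum E c
  depthSum-transfer E E' c π sumπ T =
    subst (_≤ depthSum E c) sumπ (sumTo-mono N (λ w _ → L'-transfer E E' c w (π w) (T w)))

  depthSum-shallower : ∀ E E' c (π : ℕ → ℕ) → sumTo N (λ w → L' N M E' c (π w)) ≡ depthSum E' c →
                       (∀ w → Transfer E E' c w (π w)) →
                       ∀ w b → InV N c → InV N w → InV N (π w) →
                       reach N M E' c b (π w) ≡ true → b ≺ L N M E c w → depthSum E' c < depthSum E c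
  depthSum-shallower E E' c π sumπ T w b rc rw rπw e b≺w =
    subst (_< depthSum E c) sumπ
      (sumTo-strict N (λ x _ → L'-transfer E E' c x (π x) (T x)) w rw (L'-shallower E E' c w (π w) b rc rπw e b≺w))


-- Moving the i-link into c from parent p to parent q.  Jump is a move, and in
-- each of its two colours MixSwap acts as a move.
move : ℕ → ℕ → ℕ → ℕ → Links → Links
move p q c i G = ins q c i (del p c i G)

move-elsewhere : ∀ p q c i G a b z → ¬ (c ≡ b × i ≡ z) → move p q c i G a b z ≡ G a b z
move-elsewhere p q c i G a b z ne
  rewrite sameLink-false q c i a b z (λ (_ , e₁ , e₂) → ne (e₁ , e₂))
        | sameLink-false p c i a b z (λ (_ , e₁ , e₂) → ne (e₁ , e₂)) =
  trans (∨-identityʳ _) (∧-identityʳ _)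

move-new : ∀ p q c i G → move p q c i G q c i ≡ true
move-new p q c i G = ins-hit q c i (del p c i G)

move-onlyParent : ∀ p q c i G → OnlyParent G c i p → OnlyParent (move p q c i G) c i q
move-onlyParent p q c i G only a e with ins-inv q c i (del p c i G) a c i e
... | inj₁ e′           = ⊥-elim (true≢false (trans (sym e′) (orphaned G c i p only a)))
... | inj₂ (q≡a , _ , _) = sym q≡a

module Move (N M : ℕ) where
  open Compare N M

  move-size : ∀ p q c i G → G p c i ≡ true → OnlyParent G c i p →
              InV N p → InV N q → InV N c → InV M i → size N M (move p q c i G) ≡ size N M G
  move-size p q c i G present only rp rq rc ri =
    trans (size-ins N M q c i (del p c i G) (orphaned G c i p only q) rq rc ri) (size-del N M p c i G present rp rc ri)

  move-forward : ∀ G i p q c → InV N i → InV N p → InV N q → OnlyParent G c i p →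
                 L N M G i q ≤∞ L N M G i p → ∀ w → Transfer G (move p q c i G) i w w
  move-forward G i p q c ri rp rq only q≤p w k =
    reparent G (move p q c i G) i p q c rq keep only (move-new p q c i G)
      (λ k reached e → reached q (Depth.noDeeper-Reach N M G i ri q p rp q≤p k e)) k w
    where
    keep : ∀ a b → G a b i ≡ true → b ≢ c → move p q c i G a b i ≡ true
    keep a b e b≢c = trans (move-elsewhere p q c i G a b i (λ (c≡b , _) → b≢c (sym c≡b))) e

  move-backward : ∀ G i p q c → InV N i → InV N p → InV N q → G p c i ≡ true → OnlyParent G c i p →
                  L N M G i p ≤∞ L N M G i q → ∀ w → Transfer (move p q c i G) G i w w
  move-backward G i p q c ri rp rq present only p≤q w k =
    reparent (move p q c i G) G i q p c rp keep (move-onlyParent p q c i G only) present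
      (λ k reached e → Depth.noDeeper-Reach N M G i ri p q rq p≤q k (reached q e)) k w
    where
    keep : ∀ a b → move p q c i G a b i ≡ true → b ≢ c → G a b i ≡ true
    keep a b e b≢c = trans (sym (move-elsewhere p q c i G a b i (λ (c≡b , _) → b≢c (sym c≡b)))) e

-[1+n]+1 : ∀ n → ℤ.- (ℤ.+ suc n) ℤ.+ 1ℤ ≡ ℤ.- (ℤ.+ n)
-[1+n]+1 zero    = refl
-[1+n]+1 (suc n) = refl

neg-<⇒+1≤ : ∀ m n → m < n → ℤ.- (ℤ.+ n) ℤ.+ 1ℤ ℤ.≤ ℤ.- (ℤ.+ m)
neg-<⇒+1≤ m (suc n) (s≤s m≤n) = subst (ℤ._≤ ℤ.- (ℤ.+ m)) (sym (-[1+n]+1 n)) (ℤP.neg-mono-≤ (+≤+ m≤n))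

module Potential (N M : ℕ) (E E' : Links) where

  more-links : size N M E < size N M E' → LexDecr (triple N M E') (triple N M E)
  more-links lt = inj₁ (neg-<⇒+1≤ (size N M E) (size N M E') lt)

  smaller-Y : size N M E' ≡ size N M E → Y N M E' < Y N M E → LexDecr (triple N M E') (triple N M E)
  smaller-Y e lt = inj₂ (inj₁ (cong (λ s → ℤ.- (ℤ.+ s)) e ,
                               subst (ℤ._≤ ℤ.+ Y N M E) (cong ℤ.+_ (sym (+-comm (Y N M E') 1))) (+≤+ lt)))

  larger-S : size N M E' ≡ size N M E → Y N M E' ≡ Y N M E → S N M E < S N M E' →
             LexDecr (triple N M E') (triple N M E)
  larger-S e₁ e₂ lt = inj₂ (inj₂ (cong (λ s → ℤ.- (ℤ.+ s)) e₁ , cong ℤ.+_ e₂ , neg-<⇒+1≤ (S N M E) (S N M E') lt))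

module Tree (N M : ℕ) (M≤N : M ≤ N) (E : Links) (mt : MultiTree N M E) where
  open MultiTree mt

  colour∈V : ∀ {i} → InV M i → InV N i
  colour∈V (p , q) = p , ≤-trans q M≤N

  source : ∀ {a b i} → E a b i ≡ true → InV N a
  source {a} {b} {i} e = proj₁ (wf a b i e)

  target : ∀ {a b i} → E a b i ≡ true → InV N b
  target {a} {b} {i} e = proj₁ (proj₂ (wf a b i e))

  onlyParent : ∀ {p c i} → E p c i ≡ true → OnlyParent E c i p
  onlyParent {p} {c} {i} e a e′ = uniqParent a p c i e′ e

  notRoot : ∀ {a c i} → E a c i ≡ true → c ≢ i
  notRoot {a} {c} {i} e refl = rootNoIn a c e

  noParent : ∀ {u i} → ¬ HasIn N M E u i → ∀ a → E a u i ≡ false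
  noParent {u} {i} noIn a with E a u i in e
  ... | false = refl
  ... | true  = ⊥-elim (noIn (inj₂ (a , e)))

  leaf : ∀ {i v} → dcol N M E i v ≡ 0 → ∀ {x} → E v x i ≡ true → ⊥
  leaf {i} {v} d≡0 {x} e with sumTo-zero-inv N d≡0 x (target e)
  ... | c≡0 rewrite e with c≡0
  ...   | ()

  someChild : ∀ {i u} → 1 ≤ dcol N M E i u → ∃[ c ] (E u c i ≡ true)
  someChild {i} {u} d≥1 with sumTo-pos N d≥1
  ... | c , _ , l with E u c i in e
  ...   | true  = c , e
  ...   | false = ⊥-elim (1+n≰n l)

module GreedyStep (N M K : ℕ) (dbar : ℕ → ℕ) (M≤N : M ≤ N) (E : Links) (mt : MultiTree N M E) where
  open Tree N M M≤N E mt

  -- Add inserts a link; Insert replaces (v,uc) by (v,u) and (u,uc).  Either way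
  -- |E| grows by one.
  greedy-decreases : ∀ {u v E'} → InV N u → InV N v → Greedy N M K dbar E u v true E' →
                     LexDecr (triple N M E') (triple N M E)
  greedy-decreases {u} {v} ru rv (add i _ (ri , noIn , _) _) =
    Potential.more-links N M E _ (≤-reflexive (sym (size-ins N M v u i E (noParent noIn v) rv ru ri)))
  greedy-decreases {u} {v} ru rv (insert i uc _ (ri , noIn , hasIn) _ evuc) =
    Potential.more-links N M E _ (≤-reflexive (sym grows))
    where
    D : Links
    D = del v uc i E
    ruc : InV N uc
    ruc = target evuc
    u≢v : u ≢ v
    u≢v refl = noIn hasIn
    -- u had no i-parent, and uc lost its only one.
    absent₁ : D v u i ≡ false
    absent₁ = del-absent v uc i E v u i (noParent noIn v)
    absent₂ : ins v u i D u uc i ≡ false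
    absent₂ = ins-absent v u i D u uc i (orphaned E uc i v (onlyParent evuc) u) (λ (v≡u , _) → u≢v (sym v≡u))
    grows : size N M (ins u uc i (ins v u i D)) ≡ suc (size N M E)
    grows = begin
      size N M (ins u uc i (ins v u i D)) ≡⟨ size-ins N M u uc i _ absent₂ ru ruc ri ⟩
      suc (size N M (ins v u i D))        ≡⟨ cong suc (size-ins N M v u i D absent₁ rv ru ri) ⟩
      suc (suc (size N M D))              ≡⟨ cong suc (size-del N M v uc i E evuc rv ruc ri) ⟩
      suc (size N M E)                    ∎
      where open ≡-Reasoning

-- Jump moves u under the strictly shallower v: |E| is kept and Y drops.

module JumpStep (N M : ℕ) (M≤N : M ≤ N) (E : Links) (mt : MultiTree N M E) where
  open Tree N M M≤N E mt
  open Compare N M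
  open Move N M

  jump-decreases : ∀ u v i up → InV N u → InV N v → InV M i →
                   suc∞ (L N M E i v) <∞ L N M E i u → E up u i ≡ true →
                   LexDecr (triple N M (move up v u i E)) (triple N M E)
  jump-decreases u v i up ru rv ri jc eupu with suc∞<∞-fin (L N M E i v) jc
  ... | a , ea , deeper = smaller-Y sameSize (Y-decrease E E' i ri colours shallower)
    where
    E' : Links
    E' = move up v u i E
    open Potential N M E E'
    rI : InV N i
    rI = colour∈V ri
    rup : InV N up
    rup = source eupu
    -- v is no deeper than u's old parent, so the move transfers reachability.
    T : ∀ w → Transfer E E' i w w
    T = move-forward E i up v u rI rup rv (onlyParent eupu)
          (Depth.shallower-than-parent N M E i rI up u v a eupu rup ru ea deeper)
    sameSize : size N M E' ≡ size N M E
    sameSize = move-size up v u i E eupu (onlyParent eupu) rup rv ru ri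
    colours : ∀ c → InV M c → depthSum E' c ≤ depthSum E c
    colours c _ with c ≟ i
    ... | yes refl = depthSum-transfer E E' c (λ w → w) refl T
    ... | no c≢i   = depthSum-untouched E E' c
                       (λ a b → sym (move-elsewhere up v u i E a b c (λ (_ , i≡c) → c≢i (sym i≡c))))
    -- u now hangs one hop below v.
    shallower : depthSum E' i < depthSum E i
    shallower = depthSum-shallower E E' i (λ w → w) refl T u (suc a) rI ru ru
                  (Depth.Reach-edge N M E' i a v u (T v a (proj₁ (Depth.L-fin N M E i v a ea))) (move-new up v u i E) rv)
                  deeper

-- Every node w of E reappears as τ w in E' (τ the transposition of u and v),
-- at most as deep; the children of u get strictly shallower.

module LeafSwapStep (N M : ℕ) (M≤N : M ≤ N) (E : Links) (mt : MultiTree N M E)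
                    (u v i up vp : ℕ) (ru : InV N u) (rv : InV N v) (ri : InV M i)
                    (leafV : dcol N M E i v ≡ 0) (innerU : 1 ≤ dcol N M E i u)
                    (v<u : L N M E i v <∞ L N M E i u)
                    (eupu : E up u i ≡ true) (evpv : E vp v i ≡ true) where
  open Tree N M M≤N E mt
  open Compare N M
  open Depth N M E i using (Reach; Reach-zero; Reach-inv; noDeeper-Reach; child-deeper; L-fin)

  D₁ D₂ I E' : Links
  D₁ = del up u i E
  D₂ = del vp v i D₁
  I  = ins up v i D₂
  E' = ins vp u i I

  open Potential N M E E'

  τ : ℕ → ℕ
  τ = transpose u v

  rI : InV N i
  rI = colour∈V ri
  rup : InV N up
  rup = source eupu
  rvp : InV N vp
  rvp = source evpv

  b : ℕ
  b = proj₁ (<∞-fin v<u)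

  depth-v : L N M E i v ≡ fin b
  depth-v = proj₁ (proj₂ (<∞-fin v<u))

  u-deeper : b ≺ L N M E i u
  u-deeper = proj₂ (proj₂ (<∞-fin v<u))

  u≢v : u ≢ v
  u≢v refl = <-irrefl refl (u-deeper b depth-v)

  present₁ : D₁ vp v i ≡ true
  present₁ = del-keep up u i E vp v i evpv (λ (_ , u≡v , _) → u≢v u≡v)

  absent₁ : D₂ up v i ≡ false
  absent₁ = orphaned D₁ v i vp (OnlyParent-del up u i E v i vp (onlyParent evpv)) up

  absent₂ : I vp u i ≡ false
  absent₂ = ins-absent up v i D₂ vp u i
              (del-absent vp v i D₁ vp u i (orphaned E u i up (onlyParent eupu) vp))
              (λ (_ , v≡u , _) → u≢v (sym v≡u))

  sameSize : size N M E' ≡ size N M E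
  sameSize = begin
    size N M E'                    ≡⟨ size-ins N M vp u i I absent₂ rvp ru ri ⟩
    suc (size N M I)               ≡⟨ cong suc (size-ins N M up v i D₂ absent₁ rup rv ri) ⟩
    suc (suc (size N M D₂))        ≡⟨ cong suc (size-del N M vp v i D₁ present₁ rvp rv ri) ⟩
    suc (size N M D₁)              ≡⟨ size-del N M up u i E eupu rup ru ri ⟩
    size N M E                     ∎
    where open ≡-Reasoning

  keep : ∀ a w → E a w i ≡ true → w ≢ u → w ≢ v → E' a w i ≡ true
  keep a w e w≢u w≢v =
    ins-keep vp u i I a w i (ins-keep up v i D₂ a w i
      (del-keep vp v i D₁ a w i (del-keep up u i E a w i e (λ (_ , u≡w , _) → w≢u (sym u≡w)))
                                (λ (_ , v≡w , _) → w≢v (sym v≡w))))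

  relink : ∀ a w → E a w i ≡ true → E' a (τ w) i ≡ true
  relink a w e with w ≟ u
  ... | yes refl rewrite transpose-u u v | onlyParent eupu a e = ins-keep vp u i I up v i (ins-hit up v i D₂)
  ... | no w≢u with w ≟ v
  ...   | yes refl rewrite transpose-v u v u≢v | onlyParent evpv a e = ins-hit vp u i I
  ...   | no w≢v rewrite transpose-other u v w w≢u w≢v = keep a w e w≢u w≢v

  -- An i-parent a (so a ≠ v) reached in E is reached in E' itself: for a = u
  -- this uses that v, which takes the place of u, is shallower.
  parent-reached : ∀ k a → a ≢ v → Reach k a ≡ true →
                   (∀ x → Reach k x ≡ true → reach N M E' i k (τ x) ≡ true) → reach N M E' i k a ≡ true
  parent-reached k a a≢v e T with a ≟ u
  ... | yes refl = subst (λ x → reach N M E' i k x ≡ true) (transpose-v u v u≢v)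
                     (T v (noDeeper-Reach rI v u ru (<∞⇒≤∞ v<u) k e))
  ... | no a≢u = subst (λ x → reach N M E' i k x ≡ true) (transpose-other u v a a≢u a≢v) (T a e)

  transfer : ∀ k w → Reach k w ≡ true → reach N M E' i k (τ w) ≡ true
  transfer zero w e with Reach-zero w e
  ... | refl rewrite transpose-other u v i (≢-sym (notRoot eupu)) (≢-sym (notRoot evpv)) = ≡ᵇ-refl i
  transfer (suc k) w e with Reach-inv k w e
  ... | inj₁ e′ = Depth.Reach-step N M E' i k (τ w) (transfer k w e′)
  ... | inj₂ (a , ra , ea , eaw) =
    Depth.Reach-edge N M E' i k a (τ w) (parent-reached k a (λ { refl → leaf leafV eaw }) ea (transfer k)) (relink a w eaw) ra

  sum-τ : ∀ c → sumTo N (λ w → L' N M E' c (τ w)) ≡ depthSum E' c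
  sum-τ c = sumTo-transpose N u v (λ w → L' N M E' c w) ru rv u≢v

  colours : ∀ c → InV M c → depthSum E' c ≤ depthSum E c
  colours c _ with c ≟ i
  ... | yes refl = depthSum-transfer E E' c τ (sum-τ c) (λ w k → transfer k w)
  ... | no c≢i   = depthSum-untouched E E' c (λ a w → sym (
      trans (ins-other vp u i I a w c i≢c) (trans (ins-other up v i D₂ a w c i≢c)
      (trans (del-other vp v i D₁ a w c i≢c) (del-other up u i E a w c i≢c)))))
    where
    i≢c : i ≢ c
    i≢c = ≢-sym c≢i

  -- A child c of u sits below u = τ v, which E' reaches within b hops.
  shallower : depthSum E' i < depthSum E i
  shallower with someChild innerU
  ... | c , euc =
    depthSum-shallower E E' i τ (sum-τ i) (λ w k → transfer k w) c (suc b) rI (target euc)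
      (transpose-InV N u v c ru rv (target euc))
      (Depth.Reach-edge N M E' i b u (τ c) u-reached (relink u c euc) ru)
      (child-deeper rI c u b (onlyParent euc) (notRoot euc) ru u-deeper)
    where
    u-reached : reach N M E' i b u ≡ true
    u-reached = subst (λ x → reach N M E' i b x ≡ true) (transpose-v u v u≢v)
                  (transfer b v (proj₁ (L-fin v b depth-v)))

  leafSwap-decreases : LexDecr (triple N M E') (triple N M E)
  leafSwap-decreases = smaller-Y sameSize (Y-decrease E E' i ri colours shallower)

-- In colour
-- i it moves uc under the no-deeper v, in colour j it moves vc under the
-- no-deeper u.  If some depth differs, a moved child gets shallower and Y
-- drops; otherwise all depths are kept and S grows by (u - v)(j - i).

exchange-gain : ∀ u v i j → 0ℤ ℤ.< (ℤ.+ u ℤ.- ℤ.+ v) ℤ.* (ℤ.+ j ℤ.- ℤ.+ i) → u * i + v * j < u * j + v * i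
exchange-gain u v i j pos =
  ℤP.drop‿+<+ (subst₂ ℤ._<_ (sym (pos-sum u i v j)) (sym (pos-sum u j v i))
    (diff-pos (subst (0ℤ ℤ.<_) (expand (ℤ.+ u) (ℤ.+ v) (ℤ.+ i) (ℤ.+ j)) pos)))
  where
  expand : ∀ (u v i j : ℤ) → (u ℤ.- v) ℤ.* (j ℤ.- i) ≡ (u ℤ.* j ℤ.+ v ℤ.* i) ℤ.- (u ℤ.* i ℤ.+ v ℤ.* j)
  expand = ℤ-Solver.solve-∀
  cancel : ∀ (a b : ℤ) → a ≡ (a ℤ.- b) ℤ.+ b
  cancel = ℤ-Solver.solve-∀
  diff-pos : ∀ {a b} → 0ℤ ℤ.< a ℤ.- b → b ℤ.< a
  diff-pos {a} {b} h = subst₂ ℤ._<_ (ℤP.+-identityˡ b) (sym (cancel a b)) (ℤP.+-monoˡ-< b h)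
  pos-sum : ∀ a b c d → ℤ.+ (a * b + c * d) ≡ ℤ.+ a ℤ.* ℤ.+ b ℤ.+ ℤ.+ c ℤ.* ℤ.+ d
  pos-sum a b c d = trans (ℤP.pos-+ (a * b) (c * d)) (cong₂ ℤ._+_ (ℤP.pos-* a b) (ℤP.pos-* c d))

+-exchange : ∀ d a b c e → d + a + b + (c + e) ≡ d + e + c + (a + b)
+-exchange = ℕ-Solver.solve-∀

module MixSwapStep (N M : ℕ) (M≤N : M ≤ N) (E : Links) (mt : MultiTree N M E)
                   (uc v i j vc u : ℕ) (ruc : InV N uc) (rv : InV N v)
                   (ri : InV M i) (rj : InV M j) (i≢j : i ≢ j)
                   (evvc : E v vc j ≡ true) (euuc : E u uc i ≡ true)
                   (v≤u : L N M E i v ≤∞ L N M E i u) (u≤v : L N M E j u ≤∞ L N M E j v) where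
  open Tree N M M≤N E mt
  open Compare N M
  open Move N M

  D₁ D₂ I E' : Links
  D₁ = del u uc i E
  D₂ = del v vc j D₁
  I  = ins u vc j D₂
  E' = ins v uc i I

  open Potential N M E E'

  rI : InV N i
  rI = colour∈V ri
  rJ : InV N j
  rJ = colour∈V rj
  ru : InV N u
  ru = source euuc
  rvc : InV N vc
  rvc = target evvc

  -- Colour by colour, E' is a move of E.
  slice-i : ∀ a b → E' a b i ≡ move u v uc i E a b i
  slice-i a b = cong (_∨ sameLink v uc i a b i)
    (trans (ins-other u vc j D₂ a b i i≢j′) (del-other v vc j D₁ a b i i≢j′))
    where
    i≢j′ : j ≢ i
    i≢j′ = ≢-sym i≢j

  slice-j : ∀ a b → E' a b j ≡ move v u vc j E a b j
  slice-j a b = trans (ins-other v uc i I a b j i≢j)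
    (cong (λ t → (t ∧ not (sameLink v vc j a b j)) ∨ sameLink u vc j a b j) (del-other u uc i E a b j i≢j))

  slice-other : ∀ c → c ≢ i → c ≢ j → ∀ a b → E a b c ≡ E' a b c
  slice-other c c≢i c≢j a b = sym (
    trans (ins-other v uc i I a b c (≢-sym c≢i)) (trans (ins-other u vc j D₂ a b c (≢-sym c≢j))
    (trans (del-other v vc j D₁ a b c (≢-sym c≢j)) (del-other u uc i E a b c (≢-sym c≢i)))))

  forward-i : ∀ w → Transfer E E' i w w
  forward-i w k e = trans (reach-cong E' (move u v uc i E) i slice-i k w)
                          (move-forward E i u v uc rI ru rv (onlyParent euuc) v≤u w k e)

  forward-j : ∀ w → Transfer E E' j w w
  forward-j w k e = trans (reach-cong E' (move v u vc j E) j slice-j k w)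
                          (move-forward E j v u vc rJ rv ru (onlyParent evvc) u≤v w k e)

  backward-i : L N M E i u ≡ L N M E i v → ∀ w → Transfer E' E i w w
  backward-i eq w k e = move-backward E i u v uc rI ru rv euuc (onlyParent euuc) (subst (_ ≤∞_) eq ≤∞-refl) w k
                          (trans (sym (reach-cong E' (move u v uc i E) i slice-i k w)) e)

  backward-j : L N M E j u ≡ L N M E j v → ∀ w → Transfer E' E j w w
  backward-j eq w k e = move-backward E j v u vc rJ rv ru evvc (onlyParent evvc) (subst (_≤∞ _) eq ≤∞-refl) w k
                          (trans (sym (reach-cong E' (move v u vc j E) j slice-j k w)) e)

  colours : ∀ c → InV M c → depthSum E' c ≤ depthSum E c
  colours c _ with c ≟ i | c ≟ j
  ... | yes refl | _        = depthSum-transfer E E' c (λ w → w) refl forward-i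
  ... | no _     | yes refl = depthSum-transfer E E' c (λ w → w) refl forward-j
  ... | no c≢i   | no c≢j   = depthSum-untouched E E' c (slice-other c c≢i c≢j)

  -- If v is strictly shallower than u in colour i, uc (now below v) gets shallower.
  shallower-i : L N M E i u ≢ L N M E i v → depthSum E' i < depthSum E i
  shallower-i ne with ≤∞-≢-fin v≤u ne
  ... | b , eb , b≺u =
    depthSum-shallower E E' i (λ w → w) refl forward-i uc (suc b) rI ruc ruc
      (Depth.Reach-edge N M E' i b v uc (forward-i v b (proj₁ (Depth.L-fin N M E i v b eb))) (ins-hit v uc i I) rv)
      (Depth.child-deeper N M E i rI uc u b (onlyParent euuc) (notRoot euuc) ru b≺u)

  -- Symmetrically in colour j, with vc now below u.
  shallower-j : L N M E j u ≢ L N M E j v → depthSum E' j < depthSum E j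
  shallower-j ne with ≤∞-≢-fin u≤v (≢-sym ne)
  ... | b , eb , b≺v =
    depthSum-shallower E E' j (λ w → w) refl forward-j vc (suc b) rJ rvc rvc
      (Depth.Reach-edge N M E' j b u vc (forward-j u b (proj₁ (Depth.L-fin N M E j u b eb)))
                        (ins-keep v uc i I u vc j (ins-hit u vc j D₂)) ru)
      (Depth.child-deeper N M E j rJ vc v b (onlyParent evvc) (notRoot evvc) rv b≺v)

  sameDepths : L N M E i u ≡ L N M E i v → L N M E j u ≡ L N M E j v →
               ∀ c w → InV M c → InV N w → L' N M E' c w ≡ L' N M E c w
  sameDepths eqi eqj c w _ _ with c ≟ i | c ≟ j
  ... | yes refl | _        = ≤-antisym (L'-transfer E E' c w w (forward-i w)) (L'-transfer E' E c w w (backward-i eqi w))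
  ... | no _     | yes refl = ≤-antisym (L'-transfer E E' c w w (forward-j w)) (L'-transfer E' E c w w (backward-j eqj w))
  ... | no c≢i   | no c≢j   = L'-cong E E' c (slice-other c c≢i c≢j) w

  present₁ : D₁ v vc j ≡ true
  present₁ = del-keep u uc i E v vc j evvc (λ (_ , _ , i≡j) → i≢j i≡j)

  absent₁ : D₂ u vc j ≡ false
  absent₁ = orphaned D₁ vc j v (OnlyParent-del u uc i E vc j v (onlyParent evvc)) u

  absent₂ : I v uc i ≡ false
  absent₂ = ins-absent u vc j D₂ v uc i (del-absent v vc j D₁ v uc i (orphaned E uc i u (onlyParent euuc) v))
              (λ (_ , _ , j≡i) → i≢j (sym j≡i))

  Φ-exchange : ∀ w → Φ N M w E' + (w u uc i + w v vc j) ≡ Φ N M w E + (w u vc j + w v uc i)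
  Φ-exchange w = begin
    Φ N M w E' + (w u uc i + w v vc j)
      ≡⟨ cong (_+ (w u uc i + w v vc j)) (trans (Φ-ins N M w v uc i I absent₂ rv ruc ri)
                                                (cong (_+ w v uc i) (Φ-ins N M w u vc j D₂ absent₁ ru rvc rj))) ⟩
    Φ N M w D₂ + w u vc j + w v uc i + (w u uc i + w v vc j)
      ≡⟨ +-exchange (Φ N M w D₂) (w u vc j) (w v uc i) (w u uc i) (w v vc j) ⟩
    Φ N M w D₂ + w v vc j + w u uc i + (w u vc j + w v uc i)
      ≡⟨ cong (λ t → t + w u uc i + (w u vc j + w v uc i)) (Φ-del N M w v vc j D₁ present₁ rv rvc rj) ⟩
    Φ N M w D₁ + w u uc i + (w u vc j + w v uc i)
      ≡⟨ cong (_+ (w u vc j + w v uc i)) (Φ-del N M w u uc i E euuc ru ruc ri) ⟩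
    Φ N M w E + (w u vc j + w v uc i)
      ∎
    where open ≡-Reasoning

  sameSize : size N M E' ≡ size N M E
  sameSize = +-cancelʳ-≡ 2 _ _ (subst₂ (λ s t → s + 2 ≡ t + 2) (sym (size-Φ N M E')) (sym (size-Φ N M E))
                                        (Φ-exchange (λ _ _ _ → 1)))

  -- With weight a·c, the exchange gain is (u-v)(j-i) > 0.
  S-grows : 0ℤ ℤ.< (ℤ.+ u ℤ.- ℤ.+ v) ℤ.* (ℤ.+ j ℤ.- ℤ.+ i) → S N M E < S N M E'
  S-grows pos = +-cancelʳ-< (u * i + v * j) (S N M E) (S N M E')
    (<-≤-trans (+-monoʳ-< (S N M E) (exchange-gain u v i j pos))
               (≤-reflexive (sym (subst₂ (λ s t → s + (u * i + v * j) ≡ t + (u * j + v * i))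
                                         (sym (S-Φ N M E')) (sym (S-Φ N M E)) (Φ-exchange (λ a _ c → a * c))))))

  mixSwap-decreases : (L N M E i u ≢ L N M E i v ⊎ L N M E j u ≢ L N M E j v)
                      ⊎ (L N M E i u ≡ L N M E i v × L N M E j u ≡ L N M E j v
                         × 0ℤ ℤ.< (ℤ.+ u ℤ.- ℤ.+ v) ℤ.* (ℤ.+ j ℤ.- ℤ.+ i)) →
                      LexDecr (triple N M E') (triple N M E)
  mixSwap-decreases (inj₁ (inj₁ ne))           = smaller-Y sameSize (Y-decrease E E' i ri colours (shallower-i ne))
  mixSwap-decreases (inj₁ (inj₂ ne))           = smaller-Y sameSize (Y-decrease E E' j rj colours (shallower-j ne))
  mixSwap-decreases (inj₂ (eqi , eqj , gain)) = larger-S sameSize (Y-same E E' (sameDepths eqi eqj)) (S-grows gain)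

whole-success : ∀ N M K dbar → M ≤ N → (E : Links) → MultiTree N M E →
                ∀ u v → InV N u → InV N v → ∀ {E'} → Whole N M K dbar E u v true E' →
                LexDecr (triple N M E') (triple N M E)
whole-success N M K dbar M≤N E mt u v ru rv (byGreedy g) =
  GreedyStep.greedy-decreases N M K dbar M≤N E mt ru rv g
whole-success N M K dbar M≤N E mt u v ru rv (bySingle _ (Single.jump i up (ri , _) (_ , jc) eupu)) =
  JumpStep.jump-decreases N M M≤N E mt u v i up ru rv ri jc eupu
whole-success N M K dbar M≤N E mt u v ru rv
              (bySingle _ (Single.leafSwap i up vp (ri , _) _ (leafV , innerU , v<u) eupu evpv)) =
  LeafSwapStep.leafSwap-decreases N M M≤N E mt u v i up vp ru rv ri leafV innerU v<u eupu evpv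
whole-success N M K dbar M≤N E mt u v ru rv
              (byMixSwap _ _ (MixSwap.swap i j vc p (ri , rj , i≢j , evvc , epu , v≤p , p≤v , cases))) =
  MixSwapStep.mixSwap-decreases N M M≤N E mt u v i j vc p ru rv ri rj i≢j evvc epu v≤p p≤v cases

whole-failure : ∀ {N M K dbar E u v E'} → Whole N M K dbar E u v false E' → E' ≡ E
whole-failure (byMixSwap _ _ (MixSwap.fail _)) = refl

lemma5 : (N M K : ℕ) (dbar : ℕ → ℕ) → 1 ≤ K → K ≤ M → M ≤ N →
         (E : Links) → MultiTree N M E →
         (u v : ℕ) → InV N u → InV N v →
         (b : Bool) (E' : Links) → Whole N M K dbar E u v b E' →
         (b ≡ true → LexDecr (triple N M E') (triple N M E))
         × (b ≡ false → triple N M E' ≡ triple N M E)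
lemma5 N M K dbar _ _ M≤N E mt u v ru rv true E' step =
  (λ _ → whole-success N M K dbar M≤N E mt u v ru rv step) , λ ()
lemma5 N M K dbar _ _ M≤N E mt u v ru rv false E' step =
  (λ ()) , λ _ → cong (triple N M) (whole-failure step)
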